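{- Let $n\ge1$, let $e$ be an integer-valued function on the positive divisors of $n$, and for $k\in\mathbb Z$ set $m(k)=\sum_{d\mid (k,n)}e(n/d)$ and $p(k)=\sum_{d\mid(k,n)}d\,e(d)$. Then, as polynomials in $q$, $$\sum_{d\mid n}m\Big(\frac nd\Big)dM(q,d)=\sum_{d\mid n}e(d)q^d,\qquad \sum_{d\mid n}p\Big(\frac nd\Big)dM(q,d)=\sum_{d\mid n}\frac nd\,e\Big(\frac nd\Big)q^d.$$
   Context: $(k,n)$ is the greatest common divisor, with $(0,n)=n$. $M(q,d)=\frac1d\sum_{d'\mid d}\mu(d/d')q^{d'}$ is the necklace polynomial, $\mu$ the Möbius function. -}

module Defs where

open import Data.Nat using (ℕ; zero; suc)
import Data.Nat as ℕ
open import Data.Nat.DivMod using (_/_)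
open import Data.Nat.Divisibility using (_∣?_)
open import Data.Nat.GCD using (gcd)
open import Data.Nat.Primality using (prime?)
open import Data.Integer using (ℤ; +_; -_; _+_; _*_; ∣_∣)
open import Data.List using (List; []; _∷_; filter; map; upTo; length)
open import Data.Bool.ListAction using (any)
open import Relation.Nullary.Decidable using (⌊_⌋; _×-dec_)
open import Data.Bool using (Bool; true; false; if_then_else_)

-- Exact natural-number division, used only as n / d for d a positive divisor of n.
-- (Convention n div 0 = 0; never used at d = 0.)
_div_ : ℕ → ℕ → ℕ
n div zero  = 0
n div suc d = n / suc d

divisors : ℕ → List ℕ
divisors n = filter (_∣? n) (map suc (upTo n))

sumℤ : List ℤ → ℤ
sumℤ []       = + 0
sumℤ (x ∷ xs) = x + sumℤ xs

Σ∣ : ℕ → (ℕ → ℤ) → ℤ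
Σ∣ n f = sumℤ (map f (divisors n))

squarefree : ℕ → Bool
squarefree n = Data.Bool.not (any (λ p → ⌊ (p ℕ.* p) ∣? n ⌋) (map (λ i → suc (suc i)) (upTo n)))

numPrimeDivisors : ℕ → ℕ
numPrimeDivisors n = length (filter (λ p → prime? p ×-dec (p ∣? n)) (map suc (upTo n)))

negOnePow : ℕ → ℤ
negOnePow zero    = + 1
negOnePow (suc k) = - negOnePow k

μ : ℕ → ℤ
μ n = if squarefree n then negOnePow (numPrimeDivisors n) else + 0

-- Polynomials in q with integer coefficients, represented by their coefficient function
-- (coefficient of q^i); two polynomials are equal iff all coefficients agree.
Poly : Set
Poly = ℕ → ℤ

monomial : ℤ → ℕ → Poly
monomial c d i = if ⌊ i ℕ.≟ d ⌋ then c else + 0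

Σ∣ᴾ : ℕ → (ℕ → Poly) → Poly
Σ∣ᴾ n P i = Σ∣ n (λ d → P d i)

_·ᴾ_ : ℤ → Poly → Poly
(c ·ᴾ P) i = c * P i

-- d · M(q,d) = Σ_{d' ∣ d} μ(d/d') q^{d'}   (d times the necklace polynomial; integer coefficients)
dM : ℕ → Poly
dM d = Σ∣ᴾ d (λ d' → monomial (μ (d div d')) d')

-- m(k) = Σ_{d ∣ (k,n)} e(n/d),   with (k,n) = gcd(|k|, n), so (0,n) = n
mFun : (n : ℕ) → (ℕ → ℤ) → ℤ → ℤ
mFun n e k = Σ∣ (gcd ∣ k ∣ n) (λ d → e (n div d))

pFun : (n : ℕ) → (ℕ → ℤ) → ℤ → ℤ
pFun n e k = Σ∣ (gcd ∣ k ∣ n) (λ d → + d * e d)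

-- Put F(d) = Σ_{c ∣ n, d ∣ c} E(c). The involution c ↦ n/c of the divisors of n turns
-- m(n/d) into F(d) for E = e, and p(n/d) into F(d) for E(c) = (n/c)·e(n/c), so both
-- identities read Σ_{d ∣ n} F(d)·dM(d) = Σ_{d ∣ n} E(d) q^d. Exchanging the two divisor
-- sums reduces this to the necklace identity Σ_{d ∣ c} dM(d) = q^c, that is
-- Σ_{i ∣ d ∣ c} μ(d/i) = [i = c], which is Σ_{t ∣ K} μ(t) = [K = 1] for K = c/i.
-- For K ≥ 2 take a prime p ∣ K: the divisors of K prime to p are the s ∣ K/p with p ∤ s,
-- while the multiples p·s contribute μ(p s) = −[p ∤ s]·μ(s), so the two parts cancel.

module Submission where

open import Defs

open import Data.Bool using (Bool; true; false; not; T; if_then_else_)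
open import Data.Bool.ListAction using (any)
open import Data.Bool.Properties using (⇔→≡)
open import Data.Integer using (ℤ; +_; -_; _+_; _*_)
import Data.Integer.Properties as ℤP
open import Algebra.Properties.CommutativeSemigroup ℤP.+-commutativeSemigroup using (interchange)
open import Data.List using (List; []; _∷_; _++_; filter; map; upTo; length)
import Data.List.Properties as List
open import Data.List.Membership.Propositional using (lose)
open import Data.List.Membership.Propositional.Properties using (∈-upTo⁺)
open import Data.List.Relation.Unary.All using (_∷_)
open import Data.List.Relation.Unary.Any using (satisfied)
open import Data.List.Relation.Unary.Any.Properties using (any⁺; any⁻; map⁺; map⁻)
open import Data.Nat as ℕ using (ℕ; zero; suc; _≤_; _<_; _≥_; z≤n; s≤s; NonZero; >-nonZero; _≟_)
import Data.Nat.Properties as ℕP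
open import Data.Nat.Coprimality using (Coprime; coprime-divisor)
open import Data.Nat.Divisibility
open import Data.Nat.DivMod using (_/_; m*n/n≡m; m*[n/m]≡n; m≥n⇒m/n>0; m/n≤m; n/n≡1)
open import Data.Nat.GCD using (gcd; gcd[m,n]∣m; gcd-greatest)
open import Data.Nat.Primality
  using (Prime; prime?; euclidsLemma; prime⇒irreducible; prime⇒nonZero; prime⇒nonTrivial)
open import Data.Nat.Primality.Factorisation using (factorise)
open import Data.Product using (∃-syntax; _×_; _,_)
open import Data.Sum using (_⊎_; inj₁; inj₂)
open import Function using (_∘_)
open import Function.Bundles using (_⇔_; mk⇔; Equivalence)
open import Relation.Binary.PropositionalEquality
open import Relation.Nullary using (Dec; yes; no; ¬_; ¬?)
open import Relation.Nullary.Decidable using (⌊_⌋; _×-dec_; toWitness; fromWitness)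
open import Relation.Nullary.Negation using (contradiction)
open import Relation.Unary using (Decidable)

private
  variable
    P Q R : Set
    x y z : ℤ
    f g : ℕ → ℤ
    c d m n p s : ℕ

-- Iverson brackets

-- Via ⌊_⌋ rather than does, so that monomial c d i is definitionally when (i ≟ d) c.
when : Dec P → ℤ → ℤ
when P? z = if ⌊ P? ⌋ then z else + 0

when-yes : (P? : Dec P) → P → when P? z ≡ z
when-yes (yes _) _ = refl
when-yes (no ¬p) p = contradiction p ¬p

when-no : (P? : Dec P) → ¬ P → when P? z ≡ + 0
when-no (yes p) ¬p = contradiction p ¬p
when-no (no _)  _  = refl

when-0 : (P? : Dec P) → when P? (+ 0) ≡ + 0
when-0 (yes _) = refl
when-0 (no _)  = refl

when-cong : (P? : Dec P) → (P → x ≡ y) → when P? x ≡ when P? y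
when-cong (yes p) x≡y = x≡y p
when-cong (no _)  _   = refl

when-⇔ : (P? : Dec P) (Q? : Dec Q) → (P → Q) → (Q → P) → (P → x ≡ y) →
  when P? x ≡ when Q? y
when-⇔ (yes p) Q? P→Q _ x≡y = trans (x≡y p) (sym (when-yes Q? (P→Q p)))
when-⇔ (no ¬p) Q? _ Q→P _ = sym (when-no Q? (¬p ∘ Q→P))

when-comm : (P? : Dec P) (Q? : Dec Q) → when P? (when Q? z) ≡ when Q? (when P? z)
when-comm (yes _) Q? = refl
when-comm (no _)  Q? = sym (when-0 Q?)

when-*ˡ : (P? : Dec P) → ∀ x y → when P? x * y ≡ when P? (x * y)
when-*ˡ (yes _) x y = refl
when-*ˡ (no _)  x y = ℤP.*-zeroˡ y

when-*ʳ : (P? : Dec P) → ∀ x y → x * when P? y ≡ when P? (x * y)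
when-*ʳ (yes _) x y = refl
when-*ʳ (no _)  x y = ℤP.*-zeroʳ x

when-+ : (P? : Dec P) → when P? (x + y) ≡ when P? x + when P? y
when-+ (yes _) = refl
when-+ (no _)  = refl

when-neg : (P? : Dec P) → when P? (- x) ≡ - when P? x
when-neg (yes _) = refl
when-neg (no _)  = refl

when-absorb : (P? : Dec P) (Q? : Dec Q) → (P → Q) → when P? (when Q? z) ≡ when P? z
when-absorb (yes p) Q? P→Q = when-yes Q? (P→Q p)
when-absorb (no _)  Q? _   = refl

when-split : (P? : Dec P) → x ≡ when P? x + when (¬? P?) x
when-split {x = x} (yes _) = sym (ℤP.+-identityʳ x)
when-split {x = x} (no _)  = sym (ℤP.+-identityˡ x)

when-⊎ : (P? : Dec P) (Q? : Dec Q) (R? : Dec R) →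
  (P → Q ⊎ R) → (Q → P) → (R → P) → (Q → ¬ R) → when P? z ≡ when Q? z + when R? z
when-⊎ (yes p) (yes q) (yes r) _ _ _ q→¬r = contradiction r (q→¬r q)
when-⊎ {z = z} (yes p) (yes q) (no _) _ _ _ _ = sym (ℤP.+-identityʳ z)
when-⊎ {z = z} (yes p) (no _) (yes r) _ _ _ _ = sym (ℤP.+-identityˡ z)
when-⊎ (yes p) (no ¬q) (no ¬r) P→Q⊎R _ _ _ with P→Q⊎R p
... | inj₁ q = contradiction q ¬q
... | inj₂ r = contradiction r ¬r
when-⊎ (no ¬p) (yes q) _ _ Q→P _ _ = contradiction (Q→P q) ¬p
when-⊎ (no ¬p) (no _) (yes r) _ _ R→P _ = contradiction (R→P r) ¬p
when-⊎ (no _) (no _) (no _) _ _ _ _ = refl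

-- Finite sums over 1, …, N

∑ : ℕ → (ℕ → ℤ) → ℤ
∑ zero    f = + 0
∑ (suc N) f = ∑ N f + f (suc N)

∑-cong : ∀ N → (∀ k → k < N → f (suc k) ≡ g (suc k)) → ∑ N f ≡ ∑ N g
∑-cong zero    _   = refl
∑-cong (suc N) f≡g =
  cong₂ _+_ (∑-cong N (λ k k<N → f≡g k (ℕP.m<n⇒m<1+n k<N))) (f≡g N (ℕP.n<1+n N))

∑-zero : ∀ N → (∀ k → k < N → f (suc k) ≡ + 0) → ∑ N f ≡ + 0
∑-zero zero    _   = refl
∑-zero (suc N) f≡0 =
  cong₂ _+_ (∑-zero N (λ k k<N → f≡0 k (ℕP.m<n⇒m<1+n k<N))) (f≡0 N (ℕP.n<1+n N))

∑-+ : ∀ N f g → ∑ N (λ k → f k + g k) ≡ ∑ N f + ∑ N g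
∑-+ zero    f g = refl
∑-+ (suc N) f g =
  trans (cong (_+ (f (suc N) + g (suc N))) (∑-+ N f g)) (interchange (∑ N f) (∑ N g) _ _)

∑-neg : ∀ N f → ∑ N (λ k → - f k) ≡ - ∑ N f
∑-neg zero    f = refl
∑-neg (suc N) f =
  trans (cong (_+ - f (suc N)) (∑-neg N f)) (sym (ℤP.neg-distrib-+ (∑ N f) (f (suc N))))

∑-*ˡ : ∀ N x f → x * ∑ N f ≡ ∑ N (λ k → x * f k)
∑-*ˡ zero    x f = ℤP.*-zeroʳ x
∑-*ˡ (suc N) x f = trans (ℤP.*-distribˡ-+ x (∑ N f) _) (cong (_+ x * f (suc N)) (∑-*ˡ N x f))

∑-when : ∀ N (P? : Dec P) f → when P? (∑ N f) ≡ ∑ N (λ k → when P? (f k))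
∑-when N (yes _) f = refl
∑-when N (no _)  f = sym (∑-zero N (λ _ _ → refl))

∑-swap : ∀ N M (f : ℕ → ℕ → ℤ) →
  ∑ N (λ a → ∑ M (f a)) ≡ ∑ M (λ b → ∑ N (λ a → f a b))
∑-swap zero    M f = sym (∑-zero M (λ _ _ → refl))
∑-swap (suc N) M f =
  trans (cong (_+ ∑ M (f (suc N))) (∑-swap N M f))
        (sym (∑-+ M (λ b → ∑ N (λ a → f a b)) (f (suc N))))

∑-extend : ∀ m N → m ≤ N → (∀ k → m ≤ k → k < N → f (suc k) ≡ + 0) →
  ∑ N f ≡ ∑ m f
∑-extend m zero    z≤n _   = refl
∑-extend m (suc N) m≤N f≡0 with ℕP.m≤n⇒m<n∨m≡n m≤N
... | inj₂ refl = refl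
... | inj₁ m<1+N = trans
  (cong₂ _+_
    (∑-extend m N (ℕP.≤-pred m<1+N) (λ k m≤k k<N → f≡0 k m≤k (ℕP.m<n⇒m<1+n k<N)))
    (f≡0 N (ℕP.≤-pred m<1+N) (ℕP.n<1+n N)))
  (ℤP.+-identityʳ _)

∑-δ : ∀ N x (f : ℕ → ℤ) → 1 ≤ x → (N < x → f x ≡ + 0) →
  ∑ N (λ k → when (x ≟ k) (f k)) ≡ f x
∑-δ zero    x f 1≤x beyond = sym (beyond 1≤x)
∑-δ (suc N) x f 1≤x beyond with x ≟ suc N
... | yes refl = trans (cong (_+ f x) earlier-terms-vanish) (ℤP.+-identityˡ (f x))
  where
  earlier-terms-vanish : ∑ N (λ k → when (x ≟ k) (f k)) ≡ + 0
  earlier-terms-vanish =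
    ∑-zero N (λ k k<N → when-no (x ≟ suc k) (λ x≡k → ℕP.<-irrefl (sym x≡k) (s≤s k<N)))
... | no x≢1+N = trans (ℤP.+-identityʳ _)
                       (∑-δ N x f 1≤x (λ N<x → beyond (ℕP.≤∧≢⇒< N<x (x≢1+N ∘ sym))))

∑-cofactor : ∀ N i d → .{{_ : NonZero i}} → .{{_ : NonZero d}} → d ≤ N →
  ∑ N (λ s → when (i ℕ.* s ≟ d) z) ≡ when (i ∣? d) z
∑-cofactor {z} N i d d≤N with i ∣? d
... | no i∤d = ∑-zero N (λ s _ → when-no (i ℕ.* suc s ≟ d)
                 (λ is≡d → i∤d (divides (suc s) (trans (sym is≡d) (ℕP.*-comm i (suc s))))))
... | yes (divides q d≡q*i) = trans
  (∑-cong N (λ s _ → when-⇔ (i ℕ.* suc s ≟ d) (q ≟ suc s) is≡d⇒q≡s q≡s⇒is≡d (λ _ → refl)))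
  (∑-δ N q (λ _ → z) 1≤q (λ N<q → contradiction (ℕP.≤-trans q≤d d≤N) (ℕP.<⇒≱ N<q)))
  where
  1≤q : 1 ≤ q
  1≤q = ℕP.n≢0⇒n>0 (λ q≡0 → ℕ.≢-nonZero⁻¹ d (trans d≡q*i (cong (ℕ._* i) q≡0)))
  q≤d : q ≤ d
  q≤d = subst (q ≤_) (sym d≡q*i) (ℕP.m≤m*n q i)
  is≡d⇒q≡s : ∀ {s} → i ℕ.* s ≡ d → q ≡ s
  is≡d⇒q≡s {s} is≡d =
    ℕP.*-cancelʳ-≡ q s i (trans (sym d≡q*i) (trans (sym is≡d) (ℕP.*-comm i s)))
  q≡s⇒is≡d : ∀ {s} → q ≡ s → i ℕ.* s ≡ d
  q≡s⇒is≡d refl = trans (ℕP.*-comm i q) (sym d≡q*i)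

-- Quotients and divisors

div≡/ : ∀ m n → .{{_ : NonZero n}} → m div n ≡ m / n
div≡/ m (suc n) = refl

div-nonZero : .{{_ : NonZero n}} → .{{_ : NonZero d}} → d ∣ n → NonZero (n div d)
div-nonZero {n} {d} d∣n = >-nonZero (subst (0 <_) (sym (div≡/ n d)) (m≥n⇒m/n>0 (∣⇒≤ d∣n)))

div-∣ : .{{_ : NonZero d}} → d ∣ n → n div d ∣ n
div-∣ {d} {n} d∣n = subst (_∣ n) (sym (div≡/ n d)) (m/n∣m d∣n)

div-div : .{{_ : NonZero n}} → .{{_ : NonZero d}} → d ∣ n → n div (n div d) ≡ d
div-div {d = d} (divides q refl) = begin
  (q ℕ.* d) div ((q ℕ.* d) div d) ≡⟨ cong ((q ℕ.* d) div_) (div≡/ (q ℕ.* d) d) ⟩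
  (q ℕ.* d) div ((q ℕ.* d) / d)   ≡⟨ cong ((q ℕ.* d) div_) (m*n/n≡m q d) ⟩
  (q ℕ.* d) div q                 ≡⟨ div≡/ (q ℕ.* d) q ⟩
  (q ℕ.* d) / q                   ≡⟨ cong (_/ q) (ℕP.*-comm q d) ⟩
  (d ℕ.* q) / q                   ≡⟨ m*n/n≡m d q ⟩
  d                               ∎
  where
  open ≡-Reasoning
  instance _ = ℕP.m*n≢0⇒m≢0 q

∣-div-swap : .{{_ : NonZero c}} → .{{_ : NonZero d}} → c ∣ n → d ∣ n div c → c ∣ n div d
∣-div-swap {c} {d} {n} c∣n d∣n/c = subst (c ∣_) (sym (div≡/ n d)) (m*n∣o⇒m∣o/n c d cd∣n)
  where
  cd∣n : c ℕ.* d ∣ n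
  cd∣n = subst (_∣ n) (ℕP.*-comm d c) (m∣n/o⇒m*o∣n c∣n (subst (d ∣_) (div≡/ n c) d∣n/c))

gcd-of-∣ : m ∣ n → gcd m n ≡ m
gcd-of-∣ {m} {n} m∣n = ∣-antisym (gcd[m,n]∣m m n) (gcd-greatest ∣-refl m∣n)

prime-∤⇒coprime : Prime p → ¬ p ∣ n → Coprime n p
prime-∤⇒coprime pr p∤n (d∣n , d∣p) with prime⇒irreducible pr d∣p
... | inj₁ d≡1 = d≡1
... | inj₂ refl = contradiction d∣n p∤n

prime-divisor : 2 ≤ n → ∃[ p ] Prime p × p ∣ n
prime-divisor {n} 2≤n with factorise n {{>-nonZero (ℕP.<-trans (s≤s z≤n) 2≤n)}}
... | record { factors = [] ; isFactorisation = n≡1 } = contradiction (sym n≡1) (ℕP.<⇒≢ 2≤n)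
... | record { factors = p ∷ _ ; isFactorisation = n≡p*_ ; factorsPrime = p-prime ∷ _ } =
  p , p-prime , subst (p ∣_) (sym n≡p*_) (m∣m*n _)

-- Sums over divisors

sumℤ-filter : {P : ℕ → Set} (P? : Decidable P) (f : ℕ → ℤ) → ∀ xs →
  sumℤ (map f (filter P? xs)) ≡ sumℤ (map (λ k → when (P? k) (f k)) xs)
sumℤ-filter P? f []       = refl
sumℤ-filter P? f (x ∷ xs) with P? x
... | yes _ = cong (_+_ (f x)) (sumℤ-filter P? f xs)
... | no _  = trans (sumℤ-filter P? f xs) (sym (ℤP.+-identityˡ _))

sumℤ-++ : ∀ xs ys → sumℤ (xs ++ ys) ≡ sumℤ xs + sumℤ ys
sumℤ-++ []       ys = sym (ℤP.+-identityˡ (sumℤ ys))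
sumℤ-++ (x ∷ xs) ys = trans (cong (_+_ x) (sumℤ-++ xs ys)) (sym (ℤP.+-assoc x _ _))

sumℤ-range : ∀ N f → sumℤ (map f (map suc (upTo N))) ≡ ∑ N f
sumℤ-range zero    f = refl
sumℤ-range (suc N) f = begin
  sumℤ (map f (map suc (upTo (suc N))))
    ≡⟨ cong (λ xs → sumℤ (map f (map suc xs))) (List.upTo-∷ʳ N) ⟨
  sumℤ (map f (map suc (upTo N ++ N ∷ [])))
    ≡⟨ cong (sumℤ ∘ map f) (List.map-++ suc (upTo N) _) ⟩
  sumℤ (map f (map suc (upTo N) ++ suc N ∷ []))
    ≡⟨ cong sumℤ (List.map-++ f (map suc (upTo N)) _) ⟩
  sumℤ (map f (map suc (upTo N)) ++ f (suc N) ∷ [])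
    ≡⟨ sumℤ-++ (map f (map suc (upTo N))) _ ⟩
  sumℤ (map f (map suc (upTo N))) + (f (suc N) + + 0)
    ≡⟨ cong₂ _+_ (sumℤ-range N f) (ℤP.+-identityʳ (f (suc N))) ⟩
  ∑ N f + f (suc N)
    ∎
  where open ≡-Reasoning

Σ∣-as-∑ : ∀ n f → Σ∣ n f ≡ ∑ n (λ d → when (d ∣? n) (f d))
Σ∣-as-∑ n f = trans (sumℤ-filter (_∣? n) f (map suc (upTo n))) (sumℤ-range n _)

Σ∣-as-∑≤ : ∀ N → .{{_ : NonZero n}} → n ≤ N →
  Σ∣ n f ≡ ∑ N (λ d → when (d ∣? n) (f d))
Σ∣-as-∑≤ {n} {f} N n≤N = trans (Σ∣-as-∑ n f) (sym (∑-extend n N n≤N beyond-n))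
  where
  beyond-n : ∀ k → n ≤ k → k < N → when (suc k ∣? n) (f (suc k)) ≡ + 0
  beyond-n k n≤k _ =
    when-no (suc k ∣? n) (λ k+1∣n → ℕP.<-irrefl refl (ℕP.<-≤-trans (∣⇒≤ k+1∣n) n≤k))

Σ∣-cong : ∀ n → (∀ d → .{{_ : NonZero d}} → d ∣ n → f d ≡ g d) → Σ∣ n f ≡ Σ∣ n g
Σ∣-cong {f} {g} n f≡g = begin
  Σ∣ n f                           ≡⟨ Σ∣-as-∑ n f ⟩
  ∑ n (λ d → when (d ∣? n) (f d))  ≡⟨ ∑-cong n (λ d _ → when-cong (suc d ∣? n) (f≡g (suc d))) ⟩
  ∑ n (λ d → when (d ∣? n) (g d))  ≡⟨ Σ∣-as-∑ n g ⟨
  Σ∣ n g                           ∎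
  where open ≡-Reasoning

Σ∣-zero : ∀ n → (∀ d → .{{_ : NonZero d}} → d ∣ n → f d ≡ + 0) → Σ∣ n f ≡ + 0
Σ∣-zero n f≡0 = trans (Σ∣-as-∑ n _)
  (∑-zero n (λ d _ → trans (when-cong (suc d ∣? n) (f≡0 (suc d))) (when-0 (suc d ∣? n))))

Σ∣-+ : ∀ n → Σ∣ n (λ d → f d + g d) ≡ Σ∣ n f + Σ∣ n g
Σ∣-+ {f} {g} n = begin
  Σ∣ n (λ d → f d + g d)
    ≡⟨ Σ∣-as-∑ n _ ⟩
  ∑ n (λ d → when (d ∣? n) (f d + g d))
    ≡⟨ ∑-cong n (λ d _ → when-+ (suc d ∣? n)) ⟩
  ∑ n (λ d → when (d ∣? n) (f d) + when (d ∣? n) (g d))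
    ≡⟨ ∑-+ n _ _ ⟩
  ∑ n (λ d → when (d ∣? n) (f d)) + ∑ n (λ d → when (d ∣? n) (g d))
    ≡⟨ cong₂ _+_ (Σ∣-as-∑ n f) (Σ∣-as-∑ n g) ⟨
  Σ∣ n f + Σ∣ n g
    ∎
  where open ≡-Reasoning

Σ∣-neg : ∀ n → Σ∣ n (λ d → - f d) ≡ - Σ∣ n f
Σ∣-neg {f} n = begin
  Σ∣ n (λ d → - f d)                 ≡⟨ Σ∣-as-∑ n _ ⟩
  ∑ n (λ d → when (d ∣? n) (- f d))  ≡⟨ ∑-cong n (λ d _ → when-neg (suc d ∣? n)) ⟩
  ∑ n (λ d → - when (d ∣? n) (f d))  ≡⟨ ∑-neg n _ ⟩
  - ∑ n (λ d → when (d ∣? n) (f d))  ≡⟨ cong -_ (Σ∣-as-∑ n f) ⟨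
  - Σ∣ n f                           ∎
  where open ≡-Reasoning

Σ∣-*ˡ : ∀ n x → x * Σ∣ n f ≡ Σ∣ n (λ d → x * f d)
Σ∣-*ˡ {f} n x = begin
  x * Σ∣ n f                           ≡⟨ cong (x *_) (Σ∣-as-∑ n f) ⟩
  x * ∑ n (λ d → when (d ∣? n) (f d))  ≡⟨ ∑-*ˡ n x _ ⟩
  ∑ n (λ d → x * when (d ∣? n) (f d))  ≡⟨ ∑-cong n (λ d _ → when-*ʳ (suc d ∣? n) x (f (suc d))) ⟩
  ∑ n (λ d → when (d ∣? n) (x * f d))  ≡⟨ Σ∣-as-∑ n _ ⟨
  Σ∣ n (λ d → x * f d)                 ∎
  where open ≡-Reasoning

Σ∣-*ʳ : ∀ n x → Σ∣ n f * x ≡ Σ∣ n (λ d → f d * x)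
Σ∣-*ʳ {f} n x = trans (ℤP.*-comm (Σ∣ n f) x)
  (trans (Σ∣-*ˡ n x) (Σ∣-cong n (λ d _ → ℤP.*-comm x (f d))))

Σ∣Σ∣-as-∑∑ : ∀ m n (h : ℕ → ℕ → ℤ) →
  Σ∣ m (λ a → Σ∣ n (h a)) ≡ ∑ m (λ a → ∑ n (λ b → when (a ∣? m) (when (b ∣? n) (h a b))))
Σ∣Σ∣-as-∑∑ m n h = trans (Σ∣-as-∑ m _) (∑-cong m (λ a _ →
  trans (cong (when (suc a ∣? m)) (Σ∣-as-∑ n (h (suc a)))) (∑-when n (suc a ∣? m) _)))

Σ∣-swap : ∀ m n (h : ℕ → ℕ → ℤ) →
  Σ∣ m (λ a → Σ∣ n (λ b → h a b)) ≡ Σ∣ n (λ b → Σ∣ m (λ a → h a b))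
Σ∣-swap m n h = begin
  Σ∣ m (λ a → Σ∣ n (λ b → h a b))
    ≡⟨ Σ∣Σ∣-as-∑∑ m n h ⟩
  ∑ m (λ a → ∑ n (λ b → when (a ∣? m) (when (b ∣? n) (h a b))))
    ≡⟨ ∑-swap m n _ ⟩
  ∑ n (λ b → ∑ m (λ a → when (a ∣? m) (when (b ∣? n) (h a b))))
    ≡⟨ ∑-cong n (λ b _ → ∑-cong m (λ a _ → when-comm (suc a ∣? m) (suc b ∣? n))) ⟩
  ∑ n (λ b → ∑ m (λ a → when (b ∣? n) (when (a ∣? m) (h a b))))
    ≡⟨ Σ∣Σ∣-as-∑∑ n m (λ b a → h a b) ⟨
  Σ∣ n (λ b → Σ∣ m (λ a → h a b))
    ∎
  where open ≡-Reasoning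

Σ∣-restrict : ∀ n → .{{_ : NonZero n}} → .{{_ : NonZero m}} → m ∣ n →
  Σ∣ n (λ d → when (d ∣? m) (f d)) ≡ Σ∣ m f
Σ∣-restrict {m} {f} n m∣n = begin
  Σ∣ n (λ d → when (d ∣? m) (f d))                 ≡⟨ Σ∣-as-∑ n _ ⟩
  ∑ n (λ d → when (d ∣? n) (when (d ∣? m) (f d)))  ≡⟨ ∑-cong n (λ d _ → only-divisors-of-m (suc d)) ⟩
  ∑ n (λ d → when (d ∣? m) (f d))                  ≡⟨ Σ∣-as-∑≤ n (∣⇒≤ m∣n) ⟨
  Σ∣ m f                                           ∎
  where
  open ≡-Reasoning
  only-divisors-of-m : ∀ d → when (d ∣? n) (when (d ∣? m) (f d)) ≡ when (d ∣? m) (f d)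
  only-divisors-of-m d = trans (when-comm (d ∣? n) (d ∣? m))
    (when-absorb (d ∣? m) (d ∣? n) (λ d∣m → ∣-trans d∣m m∣n))

Σ∣-multiples : ∀ K i → .{{_ : NonZero K}} → .{{_ : NonZero i}} → i ∣ K →
  Σ∣ K (λ d → when (i ∣? d) (g d)) ≡ Σ∣ (K div i) (λ s → g (i ℕ.* s))
Σ∣-multiples {g} K i i∣K = begin
  Σ∣ K (λ d → when (i ∣? d) (g d))
    ≡⟨ Σ∣-as-∑ K _ ⟩
  ∑ K (λ d → when (d ∣? K) (when (i ∣? d) (g d)))
    ≡⟨ ∑-cong K (λ d d<K → trans (sym (∑-when K (suc d ∣? K) _))
                                 (cong (when (suc d ∣? K)) (∑-cofactor K i (suc d) d<K))) ⟨
  ∑ K (λ d → ∑ K (λ s → when (d ∣? K) (when (i ℕ.* s ≟ d) (g d))))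
    ≡⟨ ∑-swap K K _ ⟩
  ∑ K (λ s → ∑ K (λ d → when (d ∣? K) (when (i ℕ.* s ≟ d) (g d))))
    ≡⟨ ∑-cong K (λ s _ → collapse (suc s)) ⟩
  ∑ K (λ s → when (i ℕ.* s ∣? K) (g (i ℕ.* s)))
    ≡⟨ ∑-cong K (λ s _ → when-⇔ (i ℕ.* suc s ∣? K) (suc s ∣? K / i)
                           (m*n∣o⇒n∣o/m i (suc s)) (m∣n/o⇒o*m∣n i∣K) (λ _ → refl)) ⟩
  ∑ K (λ s → when (s ∣? K / i) (g (i ℕ.* s)))
    ≡⟨ Σ∣-as-∑≤ K (m/n≤m K i) ⟨
  Σ∣ (K / i) (λ s → g (i ℕ.* s))
    ≡⟨ cong (λ m → Σ∣ m _) (div≡/ K i) ⟨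
  Σ∣ (K div i) (λ s → g (i ℕ.* s))
    ∎
  where
  open ≡-Reasoning
  instance _ = >-nonZero (m≥n⇒m/n>0 (∣⇒≤ i∣K))
  collapse : ∀ s → .{{_ : NonZero s}} →
    ∑ K (λ d → when (d ∣? K) (when (i ℕ.* s ≟ d) (g d))) ≡ when (i ℕ.* s ∣? K) (g (i ℕ.* s))
  collapse s = trans (∑-cong K (λ d _ → when-comm (suc d ∣? K) (i ℕ.* s ≟ suc d)))
    (∑-δ K (i ℕ.* s) (λ d → when (d ∣? K) (g d)) (ℕ.>-nonZero⁻¹ (i ℕ.* s) {{ℕP.m*n≢0 i s}})
      (λ K<is → when-no (i ℕ.* s ∣? K) (λ is∣K → ℕP.<⇒≱ K<is (∣⇒≤ is∣K))))

Σ∣-complement : ∀ n → .{{_ : NonZero n}} → Σ∣ n f ≡ Σ∣ n (λ c → f (n div c))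
Σ∣-complement {f} n = begin
  Σ∣ n f
    ≡⟨ Σ∣-as-∑ n f ⟩
  ∑ n (λ c → when (c ∣? n) (f c))
    ≡⟨ ∑-cong n (λ c _ → ∑-cofactor n (suc c) n ℕP.≤-refl) ⟨
  ∑ n (λ c → ∑ n (λ t → when (c ℕ.* t ≟ n) (f c)))
    ≡⟨ ∑-swap n n _ ⟩
  ∑ n (λ t → ∑ n (λ c → when (c ℕ.* t ≟ n) (f c)))
    ≡⟨ ∑-cong n (λ t _ → ∑-cong n (λ c _ → swap-factors (suc c) (suc t))) ⟩
  ∑ n (λ t → ∑ n (λ c → when (t ℕ.* c ≟ n) (f (n div t))))
    ≡⟨ ∑-cong n (λ t _ → ∑-cofactor n (suc t) n ℕP.≤-refl) ⟩
  ∑ n (λ t → when (t ∣? n) (f (n div t)))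
    ≡⟨ Σ∣-as-∑ n _ ⟨
  Σ∣ n (λ c → f (n div c))
    ∎
  where
  open ≡-Reasoning
  swap-factors : ∀ c t → .{{_ : NonZero t}} →
    when (c ℕ.* t ≟ n) (f c) ≡ when (t ℕ.* c ≟ n) (f (n div t))
  swap-factors c t = when-⇔ (c ℕ.* t ≟ n) (t ℕ.* c ≟ n)
    (trans (ℕP.*-comm t c)) (trans (ℕP.*-comm c t))
    (λ ct≡n → cong f (sym (trans (cong (_div t) (sym ct≡n)) (trans (div≡/ (c ℕ.* t) t) (m*n/n≡m c t)))))

Σ∣-multiples-complement : ∀ n d (E : ℕ → ℤ) → .{{_ : NonZero n}} → .{{_ : NonZero d}} → d ∣ n →
  Σ∣ n (λ c → when (d ∣? c) (E c)) ≡ Σ∣ (n div d) (λ c → E (n div c))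
Σ∣-multiples-complement n d E d∣n = begin
  Σ∣ n (λ c → when (d ∣? c) (E c))
    ≡⟨ Σ∣-complement n ⟩
  Σ∣ n (λ c → when (d ∣? n div c) (E (n div c)))
    ≡⟨ Σ∣-cong n (λ c c∣n → when-⇔ (d ∣? n div c) (c ∣? n div d)
                              (∣-div-swap c∣n) (∣-div-swap d∣n) (λ _ → refl)) ⟩
  Σ∣ n (λ c → when (c ∣? n div d) (E (n div c)))
    ≡⟨ Σ∣-restrict n (div-∣ d∣n) ⟩
  Σ∣ (n div d) (λ c → E (n div c))
    ∎
  where
  open ≡-Reasoning
  instance _ = div-nonZero d∣n

-- The Möbius function

HasSquareFactor : ℕ → Set
HasSquareFactor n = ∃[ q ] 2 ≤ q × q ℕ.* q ∣ n

squarefree≡false⇔ : .{{_ : NonZero n}} → squarefree n ≡ false ⇔ HasSquareFactor n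
squarefree≡false⇔ {n} =
  mk⇔ (to ∘ Equivalence.to not≡false⇔T) (Equivalence.from not≡false⇔T ∘ from)
  where
  not≡false⇔T : ∀ {b} → not b ≡ false ⇔ T b
  not≡false⇔T {true}  = mk⇔ _ (λ _ → refl)
  not≡false⇔T {false} = mk⇔ (λ ()) (λ ())
  squareTest : ℕ → Bool
  squareTest q = ⌊ q ℕ.* q ∣? n ⌋
  candidates : List ℕ
  candidates = map (λ i → suc (suc i)) (upTo n)
  to : T (any squareTest candidates) → HasSquareFactor n
  to sq with satisfied (map⁻ {xs = upTo n} (any⁻ squareTest candidates sq))
  ... | i , test = suc (suc i) , s≤s (s≤s z≤n) , toWitness test
  from : HasSquareFactor n → T (any squareTest candidates)
  from (suc (suc i) , _ , qq∣n) =
    any⁺ squareTest (map⁺ {f = λ i → suc (suc i)} (lose (∈-upTo⁺ i<n) (fromWitness qq∣n)))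
    where
    i<n : i < n
    i<n = ℕP.≤-trans (ℕP.n≤1+n (suc i))
                     (ℕP.≤-trans (ℕP.m≤m*n (suc (suc i)) (suc (suc i))) (∣⇒≤ qq∣n))
  from (suc zero , s≤s () , _)

squarefree-cong : .{{_ : NonZero m}} → .{{_ : NonZero n}} →
  (HasSquareFactor m → HasSquareFactor n) → (HasSquareFactor n → HasSquareFactor m) →
  squarefree m ≡ squarefree n
squarefree-cong m→n n→m = ⇔→≡ {z = false} (mk⇔
  (λ sq-m → Equivalence.from squarefree≡false⇔ (m→n (Equivalence.to squarefree≡false⇔ sq-m)))
  (λ sq-n → Equivalence.from squarefree≡false⇔ (n→m (Equivalence.to squarefree≡false⇔ sq-n))))

hasSquareFactor-*ˡ : ∀ p → HasSquareFactor s → HasSquareFactor (p ℕ.* s)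
hasSquareFactor-*ˡ p (q , 2≤q , qq∣s) = q , 2≤q , ∣-trans qq∣s (n∣m*n p)

hasSquareFactor-prime-∣ : Prime p → p ∣ s → HasSquareFactor (p ℕ.* s)
hasSquareFactor-prime-∣ {p} p-prime p∣s =
  p , ℕ.nonTrivial⇒n>1 p {{prime⇒nonTrivial p-prime}} , *-monoʳ-∣ p p∣s

hasSquareFactor-prime-∤ : Prime p → ¬ p ∣ s → HasSquareFactor (p ℕ.* s) → HasSquareFactor s
hasSquareFactor-prime-∤ {p} p-prime p∤s (q , 2≤q , qq∣ps) with p ∣? q
... | yes p∣q = contradiction (*-cancelˡ-∣ p pp∣ps) p∤s
  where
  instance _ = prime⇒nonZero p-prime
  pp∣ps : p ℕ.* p ∣ p ℕ.* _
  pp∣ps = ∣-trans (*-pres-∣ p∣q p∣q) qq∣ps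
... | no p∤q  = q , 2≤q , coprime-divisor (prime-∤⇒coprime p-prime p∤qq) qq∣ps
  where
  p∤qq : ¬ p ∣ q ℕ.* q
  p∤qq p∣qq with euclidsLemma q q p-prime p∣qq
  ... | inj₁ p∣q = p∤q p∣q
  ... | inj₂ p∣q = p∤q p∣q

length-as-sumℤ : ∀ (xs : List ℕ) → + length xs ≡ sumℤ (map (λ _ → + 1) xs)
length-as-sumℤ []       = refl
length-as-sumℤ (x ∷ xs) = cong (_+_ (+ 1)) (length-as-sumℤ xs)

numPrimeDivisors-as-∑ : ∀ n →
  + numPrimeDivisors n ≡ ∑ n (λ q → when (prime? q ×-dec q ∣? n) (+ 1))
numPrimeDivisors-as-∑ n = trans (length-as-sumℤ (filter primeDivisor? range))
  (trans (sumℤ-filter primeDivisor? (λ _ → + 1) range) (sumℤ-range n _))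
  where
  range : List ℕ
  range = map suc (upTo n)
  primeDivisor? : Decidable (λ q → Prime q × q ∣ n)
  primeDivisor? q = prime? q ×-dec q ∣? n

numPrimeDivisors-prime-* : Prime p → .{{_ : NonZero s}} → ¬ p ∣ s →
  numPrimeDivisors (p ℕ.* s) ≡ suc (numPrimeDivisors s)
numPrimeDivisors-prime-* {p} {s} p-prime p∤s = ℤP.+-injective (begin
  + numPrimeDivisors ps
    ≡⟨ numPrimeDivisors-as-∑ ps ⟩
  ∑ ps (λ q → when (prime? q ×-dec q ∣? ps) (+ 1))
    ≡⟨ ∑-cong ps (λ q _ → p-or-divisor-of-s (suc q)) ⟩
  ∑ ps (λ q → when (p ≟ q) (+ 1) + when (prime? q ×-dec q ∣? s) (+ 1))
    ≡⟨ ∑-+ ps _ _ ⟩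
  ∑ ps (λ q → when (p ≟ q) (+ 1)) + ∑ ps (λ q → when (prime? q ×-dec q ∣? s) (+ 1))
    ≡⟨ cong₂ _+_ (∑-δ ps p (λ _ → + 1) (ℕ.>-nonZero⁻¹ p) (λ ps<p → contradiction (ℕP.m≤m*n p s) (ℕP.<⇒≱ ps<p)))
                 (∑-extend s ps (ℕP.m≤n*m s p) beyond-s) ⟩
  + 1 + ∑ s (λ q → when (prime? q ×-dec q ∣? s) (+ 1))
    ≡⟨ cong (_+_ (+ 1)) (numPrimeDivisors-as-∑ s) ⟨
  + suc (numPrimeDivisors s)
    ∎)
  where
  open ≡-Reasoning
  instance _ = prime⇒nonZero p-prime
  ps : ℕ
  ps = p ℕ.* s
  split : ∀ {q} → Prime q × q ∣ ps → p ≡ q ⊎ Prime q × q ∣ s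
  split {q} (q-prime , q∣ps) with euclidsLemma p s q-prime q∣ps
  ... | inj₂ q∣s = inj₂ (q-prime , q∣s)
  ... | inj₁ q∣p with prime⇒irreducible p-prime q∣p
  ...   | inj₁ refl = contradiction refl (ℕ.nonTrivial⇒≢1 {{prime⇒nonTrivial q-prime}})
  ...   | inj₂ q≡p = inj₁ (sym q≡p)
  p-or-divisor-of-s : ∀ q → when (prime? q ×-dec q ∣? ps) (+ 1)
                          ≡ when (p ≟ q) (+ 1) + when (prime? q ×-dec q ∣? s) (+ 1)
  p-or-divisor-of-s q = when-⊎ (prime? q ×-dec q ∣? ps) (p ≟ q) (prime? q ×-dec q ∣? s) split
    (λ { refl → p-prime , m∣m*n s })
    (λ (q-prime , q∣s) → q-prime , ∣n⇒∣m*n p q∣s)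
    (λ { refl (_ , p∣s) → p∤s p∣s })
  beyond-s : ∀ k → s ≤ k → k < ps → when (prime? (suc k) ×-dec suc k ∣? s) (+ 1) ≡ + 0
  beyond-s k s≤k _ = when-no (prime? (suc k) ×-dec suc k ∣? s)
    (λ (_ , k+1∣s) → ℕP.<-irrefl refl (ℕP.<-≤-trans (∣⇒≤ k+1∣s) s≤k))

μ-prime-*-∤ : Prime p → .{{_ : NonZero s}} → ¬ p ∣ s → μ (p ℕ.* s) ≡ - μ s
μ-prime-*-∤ {p} {s} p-prime p∤s = trans
  (cong₂ (λ b k → if b then negOnePow k else + 0)
    (squarefree-cong (hasSquareFactor-prime-∤ p-prime p∤s) (hasSquareFactor-*ˡ p))
    (numPrimeDivisors-prime-* p-prime p∤s))
  (negate-if (squarefree s))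
  where
  instance
    _ = prime⇒nonZero p-prime
    _ = ℕP.m*n≢0 p s
  negate-if : ∀ b → (if b then - negOnePow (numPrimeDivisors s) else + 0)
                  ≡ - (if b then negOnePow (numPrimeDivisors s) else + 0)
  negate-if true  = refl
  negate-if false = refl

μ-prime-*-∣ : Prime p → .{{_ : NonZero s}} → p ∣ s → μ (p ℕ.* s) ≡ + 0
μ-prime-*-∣ {p} {s} p-prime p∣s =
  cong (λ b → if b then negOnePow (numPrimeDivisors (p ℕ.* s)) else + 0)
    (Equivalence.from squarefree≡false⇔ (hasSquareFactor-prime-∣ p-prime p∣s))
  where
  instance
    _ = prime⇒nonZero p-prime
    _ = ℕP.m*n≢0 p s

μ-prime-* : Prime p → .{{_ : NonZero s}} → μ (p ℕ.* s) ≡ - when (¬? (p ∣? s)) (μ s)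
μ-prime-* {p} {s} p-prime with p ∣? s
... | yes p∣s = μ-prime-*-∣ p-prime p∣s
... | no p∤s  = μ-prime-*-∤ p-prime p∤s

Σ∣-μ : ∀ K → .{{_ : NonZero K}} → Σ∣ K μ ≡ when (K ≟ 1) (+ 1)
Σ∣-μ (suc zero) = refl
Σ∣-μ K@(suc (suc _)) with prime-divisor {K} (s≤s (s≤s z≤n))
... | p , p-prime , p∣K = begin
  Σ∣ K μ
    ≡⟨ Σ∣-cong K (λ t _ → when-split (p ∣? t)) ⟩
  Σ∣ K (λ t → when (p ∣? t) (μ t) + μ′ t)
    ≡⟨ Σ∣-+ K ⟩
  Σ∣ K (λ t → when (p ∣? t) (μ t)) + Σ∣ K μ′
    ≡⟨ cong₂ _+_ multiples-of-p prime-to-p ⟩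
  - Σ∣ (K div p) μ′ + Σ∣ (K div p) μ′
    ≡⟨ ℤP.+-inverseˡ (Σ∣ (K div p) μ′) ⟩
  + 0
    ∎
  where
  open ≡-Reasoning
  instance
    _ = prime⇒nonZero p-prime
    _ = div-nonZero p∣K
  μ′ : ℕ → ℤ
  μ′ t = when (¬? (p ∣? t)) (μ t)
  multiples-of-p : Σ∣ K (λ t → when (p ∣? t) (μ t)) ≡ - Σ∣ (K div p) μ′
  multiples-of-p = trans (Σ∣-multiples K p p∣K)
    (trans (Σ∣-cong (K div p) (λ s _ → μ-prime-* p-prime)) (Σ∣-neg (K div p)))
  ∣K⇒∣K/p : ∀ {t} → t ∣ K → ¬ p ∣ t → t ∣ K div p
  ∣K⇒∣K/p {t} t∣K p∤t = coprime-divisor (prime-∤⇒coprime p-prime p∤t)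
    (subst (t ∣_) (sym (trans (cong (p ℕ.*_) (div≡/ K p)) (m*[n/m]≡n p∣K))) t∣K)
  prime-to-p : Σ∣ K μ′ ≡ Σ∣ (K div p) μ′
  prime-to-p = trans
    (Σ∣-cong K (λ t t∣K → sym (trans (when-comm (t ∣? K div p) (¬? (p ∣? t)))
                                      (when-absorb (¬? (p ∣? t)) (t ∣? K div p) (∣K⇒∣K/p t∣K)))))
    (Σ∣-restrict K (div-∣ p∣K))

Σ∣-multiples-μ : ∀ c i → .{{_ : NonZero c}} →
  Σ∣ c (λ d → when (i ∣? d) (μ (d div i))) ≡ when (i ≟ c) (+ 1)
Σ∣-multiples-μ c zero = trans
  (Σ∣-zero c (λ d _ → when-no (0 ∣? d) (ℕ.≢-nonZero⁻¹ d ∘ 0∣⇒≡0)))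
  (sym (when-no (0 ≟ c) (ℕ.≢-nonZero⁻¹ c ∘ sym)))
Σ∣-multiples-μ c i@(suc _) with i ∣? c
... | no i∤c = trans
  (Σ∣-zero c (λ d d∣c → when-no (i ∣? d) (λ i∣d → i∤c (∣-trans i∣d d∣c))))
  (sym (when-no (i ≟ c) (i∤c ∘ ∣-reflexive)))
... | yes i∣c = begin
  Σ∣ c (λ d → when (i ∣? d) (μ (d div i)))  ≡⟨ Σ∣-multiples c i i∣c ⟩
  Σ∣ (c div i) (λ s → μ ((i ℕ.* s) / i))     ≡⟨ Σ∣-cong (c div i) (λ s _ → cong μ (is/i≡s s)) ⟩
  Σ∣ (c div i) μ                            ≡⟨ Σ∣-μ (c div i) ⟩
  when (c div i ≟ 1) (+ 1)                  ≡⟨ when-⇔ (c div i ≟ 1) (i ≟ c) c/i≡1⇒i≡c i≡c⇒c/i≡1 (λ _ → refl) ⟩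
  when (i ≟ c) (+ 1)                        ∎
  where
  open ≡-Reasoning
  instance _ = div-nonZero i∣c
  c/i≡1⇒i≡c : c div i ≡ 1 → i ≡ c
  c/i≡1⇒i≡c c/i≡1 = trans (sym (ℕP.*-identityʳ i)) (trans (cong (i ℕ.*_) (sym c/i≡1)) (m*[n/m]≡n i∣c))
  i≡c⇒c/i≡1 : i ≡ c → c div i ≡ 1
  i≡c⇒c/i≡1 refl = n/n≡1 i
  is/i≡s : ∀ s → (i ℕ.* s) / i ≡ s
  is/i≡s s = trans (cong (_/ i) (ℕP.*-comm i s)) (m*n/n≡m s i)

-- Necklace polynomials

Σ∣-monomial : ∀ n i → .{{_ : NonZero n}} → Σ∣ n (λ d → monomial (f d) d i) ≡ when (i ∣? n) (f i)
Σ∣-monomial n zero = trans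
  (Σ∣-zero n (λ d _ → when-no (0 ≟ d) (ℕ.≢-nonZero⁻¹ d ∘ sym)))
  (sym (when-no (0 ∣? n) (ℕ.≢-nonZero⁻¹ n ∘ 0∣⇒≡0)))
Σ∣-monomial {f} n i@(suc _) = begin
  Σ∣ n (λ d → when (i ≟ d) (f d))
    ≡⟨ Σ∣-as-∑ n _ ⟩
  ∑ n (λ d → when (d ∣? n) (when (i ≟ d) (f d)))
    ≡⟨ ∑-cong n (λ d _ → when-comm (suc d ∣? n) (i ≟ suc d)) ⟩
  ∑ n (λ d → when (i ≟ d) (when (d ∣? n) (f d)))
    ≡⟨ ∑-δ n i (λ d → when (d ∣? n) (f d)) (s≤s z≤n)
           (λ n<i → when-no (i ∣? n) (λ i∣n → ℕP.<⇒≱ n<i (∣⇒≤ i∣n))) ⟩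
  when (i ∣? n) (f i)
    ∎
  where open ≡-Reasoning

dM-coefficient : ∀ d i → .{{_ : NonZero d}} → dM d i ≡ when (i ∣? d) (μ (d div i))
dM-coefficient d i = Σ∣-monomial d i

Σ∣-dM : ∀ c i → .{{_ : NonZero c}} → Σ∣ c (λ d → dM d i) ≡ monomial (+ 1) c i
Σ∣-dM c i = trans (Σ∣-cong c (λ d _ → dM-coefficient d i)) (Σ∣-multiples-μ c i)

Σ∣-dM-inversion : ∀ n (E : ℕ → ℤ) i → .{{_ : NonZero n}} →
  Σ∣ n (λ d → Σ∣ n (λ c → when (d ∣? c) (E c)) * dM d i) ≡ Σ∣ n (λ c → monomial (E c) c i)
Σ∣-dM-inversion n E i = begin
  Σ∣ n (λ d → Σ∣ n (λ c → when (d ∣? c) (E c)) * dM d i)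
    ≡⟨ Σ∣-cong n (λ d _ → trans (Σ∣-*ʳ n (dM d i)) (Σ∣-cong n (λ c _ → when-*-swap (d ∣? c)))) ⟩
  Σ∣ n (λ d → Σ∣ n (λ c → E c * when (d ∣? c) (dM d i)))
    ≡⟨ Σ∣-swap n n _ ⟩
  Σ∣ n (λ c → Σ∣ n (λ d → E c * when (d ∣? c) (dM d i)))
    ≡⟨ Σ∣-cong n (λ c c∣n → trans (sym (Σ∣-*ˡ n (E c))) (cong (E c *_) (Σ∣-restrict n c∣n))) ⟩
  Σ∣ n (λ c → E c * Σ∣ c (λ d → dM d i))
    ≡⟨ Σ∣-cong n (λ c _ → trans (cong (E c *_) (Σ∣-dM c i)) (scale-monomial c)) ⟩
  Σ∣ n (λ c → monomial (E c) c i)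
    ∎
  where
  open ≡-Reasoning
  when-*-swap : ∀ {P} (P? : Dec P) {x y} → when P? x * y ≡ x * when P? y
  when-*-swap P? {x} {y} = trans (when-*ˡ P? x y) (sym (when-*ʳ P? x y))
  scale-monomial : ∀ c → E c * monomial (+ 1) c i ≡ monomial (E c) c i
  scale-monomial c = trans (when-*ʳ (i ≟ c) (E c) (+ 1)) (cong (when (i ≟ c)) (ℤP.*-identityʳ (E c)))

mFun-as-Σ∣ : ∀ n d (e : ℕ → ℤ) → .{{_ : NonZero n}} → .{{_ : NonZero d}} → d ∣ n →
  mFun n e (+ (n div d)) ≡ Σ∣ n (λ c → when (d ∣? c) (e c))
mFun-as-Σ∣ n d e d∣n = trans (cong (λ k → Σ∣ k (λ c → e (n div c))) (gcd-of-∣ (div-∣ d∣n)))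
  (sym (Σ∣-multiples-complement n d e d∣n))

pFun-as-Σ∣ : ∀ n d (e : ℕ → ℤ) → .{{_ : NonZero n}} → .{{_ : NonZero d}} → d ∣ n →
  pFun n e (+ (n div d)) ≡ Σ∣ n (λ c → when (d ∣? c) (+ (n div c) * e (n div c)))
pFun-as-Σ∣ n d e d∣n = begin
  Σ∣ (gcd (n div d) n) (λ c → + c * e c)
    ≡⟨ cong (λ k → Σ∣ k (λ c → + c * e c)) (gcd-of-∣ (div-∣ d∣n)) ⟩
  Σ∣ (n div d) (λ c → + c * e c)
    ≡⟨ Σ∣-cong (n div d) (λ c c∣n/d → cong (λ m → + m * e m) (div-div (∣-trans c∣n/d (div-∣ d∣n)))) ⟨
  Σ∣ (n div d) (λ c → + (n div (n div c)) * e (n div (n div c)))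
    ≡⟨ Σ∣-multiples-complement n d (λ c → + (n div c) * e (n div c)) d∣n ⟨
  Σ∣ n (λ c → when (d ∣? c) (+ (n div c) * e (n div c)))
    ∎
  where
  open ≡-Reasoning
  instance _ = div-nonZero d∣n

mainTheorem5 : (n : ℕ) → n ≥ 1 → (e : ℕ → ℤ) →
    (∀ i → Σ∣ᴾ n (λ d → mFun n e (+ (n div d)) ·ᴾ dM d) i
             ≡ Σ∣ᴾ n (λ d → monomial (e d) d) i)
    × (∀ i → Σ∣ᴾ n (λ d → pFun n e (+ (n div d)) ·ᴾ dM d) i
             ≡ Σ∣ᴾ n (λ d → monomial (+ (n div d) * e (n div d)) d) i)
mainTheorem5 n n≥1 e =
  (λ i → trans (Σ∣-cong n (λ d d∣n → cong (_* dM d i) (mFun-as-Σ∣ n d e d∣n)))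
               (Σ∣-dM-inversion n e i)) ,
  (λ i → trans (Σ∣-cong n (λ d d∣n → cong (_* dM d i) (pFun-as-Σ∣ n d e d∣n)))
               (Σ∣-dM-inversion n (λ c → + (n div c) * e (n div c)) i))
  where instance _ = >-nonZero n≥1
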